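{- Let $T\in\mathcal{C}_m$ be a Cartesian tree with $m$ nodes whose left subtree $\mathrm{left}(T)$ has $k-1$ nodes and whose right subtree $\mathrm{right}(T)$ has $m-k$ nodes. Then $$|\mathrm{ng}(T)|=|\mathrm{ng}(\mathrm{left}(T))|+|\mathrm{ng}(\mathrm{right}(T))|+|\mathrm{ng}(T,k-1)|+|\mathrm{ng}(T,k)|.$$
   Context: Sequences consist of pairwise distinct integers; $\tau(x,i)$ exchanges $x[i]$ and $x[i+1]$. The Cartesian tree $C(x)$ of $x[1\ldots m]$ is the binary tree whose root corresponds to the position $g$ of the minimum of $x$, with left subtree $C(x[1\ldots g-1])$ and right subtree the Cartesian tree of $x[g+1\ldots m]$ (empty tree for the empty sequence). $\mathcal{C}_m$ is the set of Cartesian trees with $m$ nodes (i.e. all binary trees with $m$ nodes). For $T\in\mathcal{C}_m$ and $1\le i\le m-1$, $\mathrm{ng}(T,i)=\{C(y): \exists x,\ C(x)=T,\ y=\tau(x,i)\}$, and $\mathrm{ng}(T)=\bigcup_{i=1}^{m-1}\mathrm{ng}(T,i)$ (so $\mathrm{ng}$ of a tree with at most one node, in particular of the empty tree, is empty). Subtrees $\mathrm{left}(T),\mathrm{right}(T)$ are regarded as Cartesian trees in their own right; $\mathrm{ng}(T,0)$ and $\mathrm{ng}(T,m)$ are taken to be empty. -}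

module Defs where

open import Data.Nat using (ℕ; zero; suc; _+_; _∸_; _≤_; _<_)
open import Data.Integer using (ℤ; _⊓_) renaming (_≟_ to _≟ℤ_)
open import Data.List using (List; []; _∷_; length; foldr)
open import Data.List.Membership.Propositional using (_∈_)
open import Data.List.Relation.Unary.Unique.Propositional using (Unique)
open import Data.Product using (Σ; ∃; _×_; _,_; proj₁; proj₂)
open import Relation.Binary.PropositionalEquality using (_≡_)
open import Relation.Nullary using (yes; no)
open import Function.Bundles using (_⇔_)

-- Binary trees (shapes of Cartesian trees); leaf = empty tree.
data Tree : Set where
  leaf : Tree
  node : Tree → Tree → Tree

size : Tree → ℕ
size leaf = 0
size (node l r) = suc (size l + size r)

left : Tree → Tree
left leaf = leaf
left (node l r) = l

right : Tree → Tree
right leaf = leaf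
right (node l r) = r

splitOn : ℤ → List ℤ → List ℤ × List ℤ
splitOn m [] = [] , []
splitOn m (y ∷ ys) with y ≟ℤ m
... | yes _ = [] , ys
... | no _  = y ∷ proj₁ (splitOn m ys) , proj₂ (splitOn m ys)

-- Cartesian tree with fuel (fuel = length suffices)
cartF : ℕ → List ℤ → Tree
cartF zero _ = leaf
cartF (suc n) [] = leaf
cartF (suc n) (a ∷ xs) =
  node (cartF n (proj₁ (splitOn (foldr _⊓_ a xs) (a ∷ xs))))
       (cartF n (proj₂ (splitOn (foldr _⊓_ a xs) (a ∷ xs))))

C : List ℤ → Tree
C x = cartF (length x) x

swap0 : List ℤ → ℕ → List ℤ
swap0 (a ∷ b ∷ xs) zero = b ∷ a ∷ xs
swap0 (a ∷ xs) (suc j) = a ∷ swap0 xs j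
swap0 xs _ = xs

-- τ(x,i): exchange x[i] and x[i+1] (1-indexed, 1 ≤ i)
τ : List ℤ → ℕ → List ℤ
τ x i = swap0 x (i ∸ 1)

ngAt : Tree → ℕ → Tree → Set
ngAt T i y = (1 ≤ i) × (i < size T) ×
  (Σ (List ℤ) λ x → Unique x × C x ≡ T × C (τ x i) ≡ y)

ng : Tree → Tree → Set
ng T y = ∃ λ i → ngAt T i y

HasCard : (Tree → Set) → ℕ → Set
HasCard P n = Σ (List Tree) λ L → Unique L × length L ≡ n × (∀ t → (t ∈ L) ⇔ P t)

{-# OPTIONS --safe #-}
-- Write a duplicate-free x as p ++ μ ∷ s with μ its minimum, so that C x = node (C p) (C s).
-- A transposition at position i either lies inside p or inside s and then changes only that
-- subtree, or exchanges μ with a neighbour and then the left subtree loses or gains a node.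
-- Conversely every neighbour of L (or of R) arises inside some realisation of node L R: any
-- realisation of L can be completed by a pivot and a disjoint realisation of R lying above it.
-- Hence ng (node L R) is the union of the four families of the statement; they are pairwise
-- disjoint because the size of the left subtree separates them, except for the first two,
-- which are separated by L ∉ ng L (proved by the same case split and induction on the tree).
module Submission where

open import Defs
open import Data.Nat as ℕ using (ℕ; zero; suc; _+_; _∸_; _≤_; _<_; z≤n; s≤s)
import Data.Nat.Properties as ℕ
open import Data.Integer as ℤ using (ℤ; _⊓_; _⊔_)
import Data.Integer.Properties as ℤ
open import Data.List using (List; []; _∷_; _++_; _∷ʳ_; [_]; length; foldr; map; initLast; _∷ʳ′_)
open import Data.List.Properties using (length-++; length-map; ++-assoc; ++-conicalʳ)
open import Data.List.Membership.Propositional using (_∈_)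
open import Data.List.Membership.Propositional.Properties using (∈-insert; ∈-map⁺; ∈-map⁻; ∈-++⁺ˡ; ∈-++⁺ʳ; ∈-++⁻)
open import Data.List.Relation.Unary.Any using (here; there)
open import Data.List.Relation.Unary.All as All using (All; []; _∷_)
import Data.List.Relation.Unary.All.Properties as All
open import Data.List.Relation.Unary.AllPairs using ([]; _∷_)
open import Data.List.Relation.Unary.Unique.Propositional using (Unique)
import Data.List.Relation.Unary.Unique.Propositional.Properties as Unique
open import Data.List.Relation.Binary.Disjoint.Propositional using (Disjoint)
import Data.List.Relation.Binary.Disjoint.Propositional.Properties as Disjoint
open import Data.List.Relation.Binary.Permutation.Propositional using (_↭_; refl; prep; swap; ↭-sym)
open import Data.List.Relation.Binary.Permutation.Propositional.Properties using (All-resp-↭; ↭-length)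
open import Data.Product as Product using (∃; _×_; _,_)
open import Data.Sum as Sum using (_⊎_; inj₁; inj₂)
open import Data.Empty using (⊥; ⊥-elim)
open import Function using (_∘_)
open import Function.Bundles using (_⇔_; mk⇔; Equivalence)
open import Relation.Binary.PropositionalEquality hiding ([_])
open import Relation.Nullary using (¬_; yes; no)

foldr-⊓-≤ : ∀ a xs {y} → y ∈ a ∷ xs → foldr _⊓_ a xs ℤ.≤ y
foldr-⊓-≤ a []       (here refl)         = ℤ.≤-refl
foldr-⊓-≤ a (x ∷ xs) (here refl)         = ℤ.≤-trans (ℤ.i⊓j≤j x _) (foldr-⊓-≤ a xs (here refl))
foldr-⊓-≤ a (x ∷ xs) (there (here refl)) = ℤ.i⊓j≤i x _
foldr-⊓-≤ a (x ∷ xs) (there (there y∈)) = ℤ.≤-trans (ℤ.i⊓j≤j x _) (foldr-⊓-≤ a xs (there y∈))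

foldr-⊓-glb : ∀ {μ} a xs → All (μ ℤ.≤_) (a ∷ xs) → μ ℤ.≤ foldr _⊓_ a xs
foldr-⊓-glb a []       (μ≤a ∷ [])        = μ≤a
foldr-⊓-glb a (x ∷ xs) (μ≤a ∷ μ≤x ∷ μ≤xs) = ℤ.⊓-glb μ≤x (foldr-⊓-glb a xs (μ≤a ∷ μ≤xs))

splitOn-++-∷ : ∀ {μ} p s → All (μ ℤ.<_) p → splitOn μ (p ++ μ ∷ s) ≡ (p , s)
splitOn-++-∷ {μ} [] s [] with μ ℤ.≟ μ
... | yes _  = refl
... | no μ≢μ = ⊥-elim (μ≢μ refl)
splitOn-++-∷ {μ} (a ∷ p) s (μ<a ∷ μ<p) with a ℤ.≟ μ
... | yes a≡μ = ⊥-elim (ℤ.<⇒≢ μ<a (sym a≡μ))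
... | no _    = cong (Product.map₁ (a ∷_)) (splitOn-++-∷ p s μ<p)

length-++-∷ : ∀ {A : Set} (p : List A) μ s → length (p ++ μ ∷ s) ≡ suc (length p + length s)
length-++-∷ p μ s = trans (length-++ p) (ℕ.+-suc (length p) (length s))

-- The split at the first occurrence of the minimum, which is the one cartF performs.
data MinView : List ℤ → Set where
  []    : MinView []
  split : ∀ {p μ s} → All (μ ℤ.<_) p → All (μ ℤ.≤_) s → MinView (p ++ μ ∷ s)

minView : ∀ x → MinView x
minView []       = []
minView (a ∷ xs) with minView xs
... | [] = split [] []
... | split {p} {μ} {s} μ<p μ≤s with a ℤ.≤? μ
...   | yes a≤μ = split [] (All.++⁺ (All.map (ℤ.≤-trans a≤μ ∘ ℤ.<⇒≤) μ<p) (a≤μ ∷ All.map (ℤ.≤-trans a≤μ) μ≤s))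
...   | no a≰μ  = split (ℤ.≰⇒> a≰μ ∷ μ<p) μ≤s

module _ (P : List ℤ → Set) (P[] : P [])
         (P-split : ∀ {p μ s} → All (μ ℤ.<_) p → All (μ ℤ.≤_) s → P p → P s → P (p ++ μ ∷ s)) where

  minView-induction : ∀ x → P x
  minView-induction x = go (length x) x ℕ.≤-refl
    where
    go : ∀ n x → length x ≤ n → P x
    go n x |x|≤n with minView x
    ... | []                        = P[]
    ... | split {p} {μ} {s} μ<p μ≤s with subst (_≤ n) (length-++-∷ p μ s) |x|≤n
    ...   | s≤s |p|+|s|≤m =
      P-split μ<p μ≤s (go _ p (ℕ.m+n≤o⇒m≤o _ |p|+|s|≤m)) (go _ s (ℕ.m+n≤o⇒n≤o _ |p|+|s|≤m))

cartF-suc : ∀ {p μ s} → All (μ ℤ.<_) p → All (μ ℤ.≤_) s → ∀ n →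
            cartF (suc n) (p ++ μ ∷ s) ≡ node (cartF n p) (cartF n s)
cartF-suc {p} {μ} {s} μ<p μ≤s n with p ++ μ ∷ s in eq
... | [] with () ← ++-conicalʳ p (μ ∷ s) eq
... | a ∷ xs = cong (λ (l , r) → node (cartF n l) (cartF n r)) (begin
  splitOn (foldr _⊓_ a xs) (a ∷ xs) ≡⟨ cong (λ m → splitOn m (a ∷ xs)) foldr-⊓≡μ ⟩
  splitOn μ (a ∷ xs)                ≡⟨ cong (splitOn μ) eq ⟨
  splitOn μ (p ++ μ ∷ s)            ≡⟨ splitOn-++-∷ p s μ<p ⟩
  (p , s)                           ∎)
  where
  open ≡-Reasoning
  foldr-⊓≡μ : foldr _⊓_ a xs ≡ μ
  foldr-⊓≡μ = ℤ.≤-antisym (foldr-⊓-≤ a xs (subst (μ ∈_) eq (∈-insert p)))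
    (foldr-⊓-glb a xs (subst (All (μ ℤ.≤_)) eq (All.++⁺ (All.map ℤ.<⇒≤ μ<p) (ℤ.≤-refl ∷ μ≤s))))

cartF-nil : ∀ n → cartF n [] ≡ leaf
cartF-nil zero    = refl
cartF-nil (suc n) = refl

cartF-fuel : ∀ x {m n} → length x ≤ m → length x ≤ n → cartF m x ≡ cartF n x
cartF-fuel = minView-induction FuelIrrelevant (λ {m} {n} _ _ → trans (cartF-nil m) (sym (cartF-nil n))) step
  where
  FuelIrrelevant : List ℤ → Set
  FuelIrrelevant x = ∀ {m n} → length x ≤ m → length x ≤ n → cartF m x ≡ cartF n x
  step : ∀ {p μ s} → All (μ ℤ.<_) p → All (μ ℤ.≤_) s →
         FuelIrrelevant p → FuelIrrelevant s → FuelIrrelevant (p ++ μ ∷ s)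
  step {p} {μ} {s} μ<p μ≤s ih-p ih-s {m} {n} |x|≤m |x|≤n
    with subst (_≤ m) (length-++-∷ p μ s) |x|≤m | subst (_≤ n) (length-++-∷ p μ s) |x|≤n
  ... | s≤s le-m | s≤s le-n = begin
    cartF (suc _) (p ++ μ ∷ s)    ≡⟨ cartF-suc μ<p μ≤s _ ⟩
    node (cartF _ p) (cartF _ s)  ≡⟨ cong₂ node (ih-p (ℕ.m+n≤o⇒m≤o _ le-m) (ℕ.m+n≤o⇒m≤o _ le-n))
                                                (ih-s (ℕ.m+n≤o⇒n≤o _ le-m) (ℕ.m+n≤o⇒n≤o _ le-n)) ⟩
    node (cartF _ p) (cartF _ s)  ≡⟨ cartF-suc μ<p μ≤s _ ⟨
    cartF (suc _) (p ++ μ ∷ s)    ∎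
    where open ≡-Reasoning

C-++-∷ : ∀ {p μ s} → All (μ ℤ.<_) p → All (μ ℤ.≤_) s → C (p ++ μ ∷ s) ≡ node (C p) (C s)
C-++-∷ {p} {μ} {s} μ<p μ≤s = begin
  cartF (length (p ++ μ ∷ s)) (p ++ μ ∷ s)
    ≡⟨ cong (λ n → cartF n (p ++ μ ∷ s)) (length-++-∷ p μ s) ⟩
  cartF (suc (length p + length s)) (p ++ μ ∷ s)
    ≡⟨ cartF-suc μ<p μ≤s _ ⟩
  node (cartF (length p + length s) p) (cartF (length p + length s) s)
    ≡⟨ cong₂ node (cartF-fuel p (ℕ.m≤m+n _ _) ℕ.≤-refl) (cartF-fuel s (ℕ.m≤n+m _ _) ℕ.≤-refl) ⟩
  node (C p) (C s)
    ∎
  where open ≡-Reasoning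

size-C : ∀ x → size (C x) ≡ length x
size-C = minView-induction (λ x → size (C x) ≡ length x) refl
  λ {p} {μ} {s} μ<p μ≤s ih-p ih-s → begin
    size (C (p ++ μ ∷ s))        ≡⟨ cong size (C-++-∷ μ<p μ≤s) ⟩
    suc (size (C p) + size (C s)) ≡⟨ cong suc (cong₂ _+_ ih-p ih-s) ⟩
    suc (length p + length s)     ≡⟨ length-++-∷ p μ s ⟨
    length (p ++ μ ∷ s)           ∎
  where open ≡-Reasoning

Unique-++⁻ : ∀ {A : Set} (xs : List A) {ys} → Unique (xs ++ ys) → Unique xs × Unique ys
Unique-++⁻ []       u           = [] , u
Unique-++⁻ (x ∷ xs) (x∉xs ∷ u) = Product.map₁ (All.++⁻ˡ xs x∉xs ∷_) (Unique-++⁻ xs u)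

Unique-++-∷⁺ : ∀ {p μ s} → Unique p → Unique s → All (μ ℤ.<_) p → All (μ ℤ.<_) s → Disjoint p s →
               Unique (p ++ μ ∷ s)
Unique-++-∷⁺ up us μ<p μ<s p#s = Unique.++⁺ up (All.map ℤ.<⇒≢ μ<s ∷ us) λ where
  (v∈p , here refl)  → ℤ.<-irrefl refl (All.lookup μ<p v∈p)
  (v∈p , there v∈s) → p#s (v∈p , v∈s)

separated : ∀ {h xs ys} → All (ℤ._< h) xs → All (h ℤ.<_) ys → Disjoint xs ys
separated xs<h h<ys (v∈xs , v∈ys) = ℤ.<-asym (All.lookup xs<h v∈xs) (All.lookup h<ys v∈ys)

∃-lowerBound : ∀ xs → ∃ λ b → All (b ℤ.<_) xs
∃-lowerBound []       = ℤ.0ℤ , []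
∃-lowerBound (x ∷ xs) with ∃-lowerBound xs
... | b , b<xs = ℤ.pred m , ℤ.<-≤-trans pred-m<m (ℤ.i⊓j≤i x b)
                          ∷ All.map (ℤ.<-trans (ℤ.<-≤-trans pred-m<m (ℤ.i⊓j≤j x b))) b<xs
  where
  m = x ⊓ b
  pred-m<m : ℤ.pred m ℤ.< m
  pred-m<m = ℤ.i≤pred[j]⇒i<j ℤ.≤-refl

∃-upperBound : ∀ xs → ∃ λ h → All (ℤ._< h) xs
∃-upperBound []       = ℤ.0ℤ , []
∃-upperBound (x ∷ xs) with ∃-upperBound xs
... | h , xs<h = ℤ.suc m , ℤ.≤-<-trans (ℤ.i≤i⊔j x h) m<suc-m
                         ∷ All.map (λ v<h → ℤ.<-trans v<h (ℤ.≤-<-trans (ℤ.i≤j⊔i x h) m<suc-m)) xs<h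
  where
  m = x ⊔ h
  m<suc-m : m ℤ.< ℤ.suc m
  m<suc-m = ℤ.suc[i]≤j⇒i<j ℤ.≤-refl

mutual
  realise : ∀ t b → ∃ λ y → Unique y × All (b ℤ.<_) y × C y ≡ t
  realise leaf       b = [] , [] , [] , refl
  realise (node l r) b with realise l (ℤ.suc b)
  ... | p , up , b+1<p , refl with realise-apart p b+1<p r
  ... | s , us , b+1<s , p#s , refl =
    p ++ ℤ.suc b ∷ s , Unique-++-∷⁺ up us b+1<p b+1<s p#s ,
    All.++⁺ (All.map (ℤ.<-trans b<b+1) b+1<p) (b<b+1 ∷ All.map (ℤ.<-trans b<b+1) b+1<s) ,
    C-++-∷ b+1<p (All.map ℤ.<⇒≤ b+1<s)
    where
    b<b+1 : b ℤ.< ℤ.suc b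
    b<b+1 = ℤ.suc[i]≤j⇒i<j ℤ.≤-refl

  realise-apart : ∀ {μ} x → All (μ ℤ.<_) x → ∀ t →
                  ∃ λ y → Unique y × All (μ ℤ.<_) y × Disjoint x y × C y ≡ t
  realise-apart {μ} x μ<x t with ∃-upperBound (μ ∷ x)
  ... | h , μ<h ∷ x<h with realise t h
  ... | y , uy , h<y , cy = y , uy , All.map (ℤ.<-trans μ<h) h<y , separated x<h h<y , cy

swap0-∷ : ∀ (a : ℤ) xs j → swap0 (a ∷ xs) (suc j) ≡ a ∷ swap0 xs j
swap0-∷ a []       j = refl
swap0-∷ a (b ∷ xs) j = refl

swap0-↭ : ∀ xs j → swap0 xs j ↭ xs
swap0-↭ []           j       = refl
swap0-↭ (a ∷ [])     zero    = refl
swap0-↭ (a ∷ [])     (suc j) = refl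
swap0-↭ (a ∷ b ∷ xs) zero    = swap b a refl
swap0-↭ (a ∷ b ∷ xs) (suc j) = prep a (swap0-↭ (b ∷ xs) j)

swap0-++ˡ : ∀ p q j → suc j < length p → swap0 (p ++ q) j ≡ swap0 p j ++ q
swap0-++ˡ (a ∷ [])    q j       (s≤s ())
swap0-++ˡ (a ∷ b ∷ p) q zero    _           = refl
swap0-++ˡ (a ∷ b ∷ p) q (suc j) (s≤s j+1<) = cong (a ∷_) (swap0-++ˡ (b ∷ p) q j j+1<)

swap0-++ʳ : ∀ p r j → swap0 (p ++ r) (length p + j) ≡ p ++ swap0 r j
swap0-++ʳ []      r j = refl
swap0-++ʳ (a ∷ p) r j = trans (swap0-∷ a (p ++ r) (length p + j)) (cong (a ∷_) (swap0-++ʳ p r j))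

swap0-++-∷-∷ : ∀ q (a b : ℤ) r → swap0 (q ++ a ∷ b ∷ r) (length q) ≡ q ++ b ∷ a ∷ r
swap0-++-∷-∷ []      a b r = refl
swap0-++-∷-∷ (c ∷ q) a b r =
  trans (swap0-∷ c (q ++ a ∷ b ∷ r) (length q)) (cong (c ∷_) (swap0-++-∷-∷ q a b r))

All-swap0 : ∀ {P : ℤ → Set} {xs} j → All P xs → All P (swap0 xs j)
All-swap0 j = All-resp-↭ (↭-sym (swap0-↭ _ j))

C-swap0-prefix : ∀ {p μ s} j → All (μ ℤ.<_) p → All (μ ℤ.≤_) s → suc j < length p →
                 C (swap0 (p ++ μ ∷ s) j) ≡ node (C (swap0 p j)) (C s)
C-swap0-prefix {p} {μ} {s} j μ<p μ≤s j+1<p =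
  trans (cong C (swap0-++ˡ p (μ ∷ s) j j+1<p)) (C-++-∷ (All-swap0 j μ<p) μ≤s)

C-swap0-suffix : ∀ {p μ s} j → All (μ ℤ.<_) p → All (μ ℤ.≤_) s →
                 C (swap0 (p ++ μ ∷ s) (length p + suc j)) ≡ node (C p) (C (swap0 s j))
C-swap0-suffix {p} {μ} {s} j μ<p μ≤s =
  trans (cong C (trans (swap0-++ʳ p (μ ∷ s) (suc j)) (cong (p ++_) (swap0-∷ μ s j))))
        (C-++-∷ μ<p (All-swap0 j μ≤s))

C-swap0-pivot-left : ∀ {q z μ s} → All (μ ℤ.<_) (q ∷ʳ z) → All (μ ℤ.≤_) s →
                     C (swap0 ((q ∷ʳ z) ++ μ ∷ s) (length q)) ≡ node (C q) (C (z ∷ s))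
C-swap0-pivot-left {q} {z} {μ} {s} μ<qz μ≤s with All.∷ʳ⁻ μ<qz
... | μ<q , μ<z =
  trans (cong C (trans (cong (λ y → swap0 y (length q)) (++-assoc q [ z ] (μ ∷ s))) (swap0-++-∷-∷ q z μ s)))
        (C-++-∷ μ<q (ℤ.<⇒≤ μ<z ∷ μ≤s))

C-swap0-pivot-right : ∀ {p μ z s} → All (μ ℤ.<_) p → μ ℤ.< z → All (μ ℤ.≤_) s →
                      C (swap0 (p ++ μ ∷ z ∷ s) (length p)) ≡ node (C (p ∷ʳ z)) (C s)
C-swap0-pivot-right {p} {μ} {z} {s} μ<p μ<z μ≤s =
  trans (cong C (trans (swap0-++-∷-∷ p μ z s) (sym (++-assoc p [ z ] (μ ∷ s)))))
        (C-++-∷ (All.∷ʳ⁺ μ<p μ<z) μ≤s)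

data Pivoted : List ℤ → Tree → Set where
  pivoted : ∀ {p μ s} → All (μ ℤ.<_) p → All (μ ℤ.<_) s → Unique p → Unique s →
            Pivoted (p ++ μ ∷ s) (node (C p) (C s))

pivot : ∀ {x L R} → Unique x → C x ≡ node L R → Pivoted x (node L R)
pivot {x} ux cx with minView x
pivot ux () | []
... | split {p} {μ} {s} μ<p μ≤s with Unique-++⁻ p ux
...   | up , μ∉s ∷ us with trans (sym cx) (C-++-∷ μ<p μ≤s)
...     | refl = pivoted μ<p (All.zipWith (Product.uncurry ℤ.≤∧≢⇒<) (μ≤s , μ∉s)) up us

-- τ x i exchanges the entries at positions i and i + 1 (counting from 1); when the left
-- subtree has k nodes, the root entry is at position k + 1.
data Position (k : ℕ) : ℕ → Set where
  within-left  : ∀ {i} → i < k → Position k i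
  before-root  : Position k k
  at-root      : Position k (suc k)
  within-right : ∀ j → Position k (suc k + suc j)

position : ∀ k i → Position k i
position zero    zero          = before-root
position zero    (suc zero)    = at-root
position zero    (suc (suc j)) = within-right j
position (suc k) zero          = within-left (s≤s z≤n)
position (suc k) (suc i) with position k i
... | within-left i<k = within-left (s≤s i<k)
... | before-root     = before-root
... | at-root         = at-root
... | within-right j  = within-right j

ngAt-size : ∀ {T i t} → ngAt T i t → size t ≡ size T
ngAt-size {i = zero}  (() , _)
ngAt-size {i = suc j} (_ , _ , x , _ , refl , refl) =
  trans (size-C (swap0 x j)) (trans (↭-length (swap0-↭ x j)) (sym (size-C x)))

ngAt-node-left⁻ : ∀ {L R i t} → i < size L → ngAt (node L R) i t →
                  ∃ λ L' → ngAt L i L' × t ≡ node L' R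
ngAt-node-left⁻ {i = zero}  _   (() , _)
ngAt-node-left⁻ {i = suc j} i<l (_ , _ , x , ux , cx , refl) with pivot ux cx
... | pivoted {p} μ<p μ<s up _ =
  C (swap0 p j) , (s≤s z≤n , i<l , p , up , refl , refl) ,
  C-swap0-prefix j μ<p (All.map ℤ.<⇒≤ μ<s) (subst (suc j <_) (size-C p) i<l)

ngAt-node-right⁻ : ∀ {L R j t} → ngAt (node L R) (suc (size L) + suc j) t →
                   ∃ λ R' → ngAt R (suc j) R' × t ≡ node L R'
ngAt-node-right⁻ {j = j} (_ , i<n , x , ux , cx , refl) with pivot ux cx
... | pivoted {p} {μ} {s} μ<p μ<s _ us =
  C (swap0 s j) , (s≤s z≤n , ℕ.+-cancelˡ-< (size (C p)) _ _ (ℕ.≤-pred i<n) , s , us , refl , refl) ,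
  trans (cong (λ n → C (swap0 (p ++ μ ∷ s) (n + suc j))) (size-C p))
        (C-swap0-suffix j μ<p (All.map ℤ.<⇒≤ μ<s))

ngAt-node-before-root⁻ : ∀ {L R t} → ngAt (node L R) (size L) t → suc (size (left t)) ≡ size L
ngAt-node-before-root⁻ (1≤l , _ , x , ux , cx , refl) with pivot ux cx
... | pivoted {p} {μ} {s} μ<p μ<s _ _ with initLast p
...   | [] with () ← 1≤l
...   | q ∷ʳ′ z = begin
  suc (size (left (C (swap0 ((q ∷ʳ z) ++ μ ∷ s) (size (C (q ∷ʳ z)) ∸ 1)))))
    ≡⟨ cong (λ n → suc (size (left (C (swap0 ((q ∷ʳ z) ++ μ ∷ s) (n ∸ 1)))))) |qz|≡ ⟩
  suc (size (left (C (swap0 ((q ∷ʳ z) ++ μ ∷ s) (length q)))))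
    ≡⟨ cong (suc ∘ size ∘ left) (C-swap0-pivot-left μ<p (All.map ℤ.<⇒≤ μ<s)) ⟩
  suc (size (C q))       ≡⟨ cong suc (size-C q) ⟩
  suc (length q)         ≡⟨ |qz|≡ ⟨
  size (C (q ∷ʳ z))      ∎
  where
  open ≡-Reasoning
  |qz|≡ : size (C (q ∷ʳ z)) ≡ suc (length q)
  |qz|≡ = trans (size-C (q ∷ʳ z)) (trans (length-++ q) (ℕ.+-comm (length q) 1))

ngAt-node-at-root⁻ : ∀ {L R t} → ngAt (node L R) (suc (size L)) t → size (left t) ≡ suc (size L)
ngAt-node-at-root⁻ (_ , l+1<n , x , ux , cx , refl) with pivot ux cx
... | pivoted {p} {μ} {[]} _ _ _ _ =
  ⊥-elim (ℕ.<-irrefl (cong suc (sym (ℕ.+-identityʳ _))) l+1<n)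
... | pivoted {p} {μ} {z ∷ s} μ<p (μ<z ∷ μ<s) _ _ = begin
  size (left (C (swap0 (p ++ μ ∷ z ∷ s) (size (C p)))))
    ≡⟨ cong (λ n → size (left (C (swap0 (p ++ μ ∷ z ∷ s) n)))) (size-C p) ⟩
  size (left (C (swap0 (p ++ μ ∷ z ∷ s) (length p))))
    ≡⟨ cong (size ∘ left) (C-swap0-pivot-right μ<p μ<z (All.map ℤ.<⇒≤ μ<s)) ⟩
  size (C (p ∷ʳ z))      ≡⟨ size-C (p ∷ʳ z) ⟩
  length (p ∷ʳ z)        ≡⟨ trans (length-++ p) (ℕ.+-comm (length p) 1) ⟩
  suc (length p)         ≡⟨ cong suc (size-C p) ⟨
  suc (size (C p))       ∎
  where open ≡-Reasoning

ngAt-node-left⁺ : ∀ {L R i L'} → ngAt L i L' → ngAt (node L R) i (node L' R)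
ngAt-node-left⁺ {i = zero} (() , _)
ngAt-node-left⁺ {R = R} {i = suc j} (_ , i<l , x , ux , refl , refl) with ∃-lowerBound x
... | μ , μ<x with realise-apart x μ<x R
... | y , uy , μ<y , x#y , refl =
  s≤s z≤n , ℕ.<-≤-trans i<l (ℕ.m≤n⇒m≤1+n (ℕ.m≤m+n _ _)) ,
  x ++ μ ∷ y , Unique-++-∷⁺ ux uy μ<x μ<y x#y , C-++-∷ μ<x (All.map ℤ.<⇒≤ μ<y) ,
  C-swap0-prefix j μ<x (All.map ℤ.<⇒≤ μ<y) (subst (suc j <_) (size-C x) i<l)

ngAt-node-right⁺ : ∀ {L R i R'} → ngAt R i R' → ngAt (node L R) (suc (size L) + i) (node L R')
ngAt-node-right⁺ {i = zero} (() , _)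
ngAt-node-right⁺ {L = L} {i = suc j} (_ , i<r , x , ux , refl , refl) with ∃-lowerBound x
... | μ , μ<x with realise-apart x μ<x L
... | y , uy , μ<y , x#y , refl =
  s≤s z≤n , s≤s (ℕ.+-monoʳ-< (size (C y)) i<r) ,
  y ++ μ ∷ x , Unique-++-∷⁺ uy ux μ<y μ<x (Disjoint.sym x#y) , C-++-∷ μ<y (All.map ℤ.<⇒≤ μ<x) ,
  trans (cong (λ n → C (swap0 (y ++ μ ∷ x) (n + suc j))) (size-C y))
        (C-swap0-suffix j μ<y (All.map ℤ.<⇒≤ μ<x))

ngAt-irrefl : ∀ T {i} → ¬ ngAt T i T
ngAt-irrefl leaf       (_ , () , _)
ngAt-irrefl (node L R) {i} h with position (size L) i
... | within-left i<l with ngAt-node-left⁻ i<l h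
...   | L' , h' , e = ngAt-irrefl L (subst (ngAt L i) (cong left (sym e)) h')
ngAt-irrefl (node L R) h | before-root    = ℕ.1+n≢n (ngAt-node-before-root⁻ h)
ngAt-irrefl (node L R) h | at-root        = ℕ.1+n≢n (sym (ngAt-node-at-root⁻ h))
ngAt-irrefl (node L R) h | within-right j with ngAt-node-right⁻ h
...   | R' , h' , e = ngAt-irrefl R (subst (ngAt R (suc j)) (cong right (sym e)) h')

HasCard-resp : ∀ {P Q : Tree → Set} {n} → (∀ t → P t ⇔ Q t) → HasCard P n → HasCard Q n
HasCard-resp P⇔Q (xs , u , |xs| , ∈⇔P) =
  xs , u , |xs| , λ t → mk⇔ (Equivalence.to (P⇔Q t) ∘ Equivalence.to (∈⇔P t))
                            (Equivalence.from (∈⇔P t) ∘ Equivalence.from (P⇔Q t))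

HasCard-image : ∀ {P : Tree → Set} {n} (f : Tree → Tree) → (∀ {u v} → f u ≡ f v → u ≡ v) →
                HasCard P n → HasCard (λ t → ∃ λ u → P u × t ≡ f u) n
HasCard-image {P} f f-inj (xs , u , |xs| , ∈⇔P) =
  map f xs , Unique.map⁺ f-inj u , trans (length-map f xs) |xs| , λ t → mk⇔ (to t) (from t)
  where
  to : ∀ t → t ∈ map f xs → ∃ λ u → P u × t ≡ f u
  to t t∈ with ∈-map⁻ f t∈
  ... | u , u∈ , refl = u , Equivalence.to (∈⇔P u) u∈ , refl
  from : ∀ t → (∃ λ u → P u × t ≡ f u) → t ∈ map f xs
  from t (u , Pu , refl) = ∈-map⁺ f (Equivalence.from (∈⇔P u) Pu)

HasCard-⊎ : ∀ {P Q : Tree → Set} {m n} → (∀ {t} → P t → Q t → ⊥) →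
            HasCard P m → HasCard Q n → HasCard (λ t → P t ⊎ Q t) (m + n)
HasCard-⊎ P#Q (xs , uxs , |xs| , ∈⇔P) (ys , uys , |ys| , ∈⇔Q) =
  xs ++ ys ,
  Unique.++⁺ uxs uys (λ (t∈xs , t∈ys) → P#Q (Equivalence.to (∈⇔P _) t∈xs) (Equivalence.to (∈⇔Q _) t∈ys)) ,
  trans (length-++ xs) (cong₂ _+_ |xs| |ys|) ,
  λ t → mk⇔ (Sum.map (Equivalence.to (∈⇔P t)) (Equivalence.to (∈⇔Q t)) ∘ ∈-++⁻ xs)
            (Sum.[ ∈-++⁺ˡ ∘ Equivalence.from (∈⇔P t) , ∈-++⁺ʳ xs ∘ Equivalence.from (∈⇔Q t) ])

module _ (L R : Tree) where

  LeftNeighbour RightNeighbour : Tree → Set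
  LeftNeighbour  t = ∃ λ L' → ng L L' × t ≡ node L' R
  RightNeighbour t = ∃ λ R' → ng R R' × t ≡ node L R'

  NodeNeighbour : Tree → Set
  NodeNeighbour t = ((LeftNeighbour t ⊎ RightNeighbour t) ⊎ ngAt (node L R) (size L) t)
                    ⊎ ngAt (node L R) (suc (size L)) t

  NodeNeighbour⇔ng : ∀ t → NodeNeighbour t ⇔ ng (node L R) t
  NodeNeighbour⇔ng t = mk⇔ from to
    where
    to : ng (node L R) t → NodeNeighbour t
    to (i , h) with position (size L) i
    ... | within-left i<l with ngAt-node-left⁻ i<l h
    ...   | L' , h' , e = inj₁ (inj₁ (inj₁ (L' , (i , h') , e)))
    to (_ , h) | before-root    = inj₁ (inj₂ h)
    to (_ , h) | at-root        = inj₂ h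
    to (_ , h) | within-right j with ngAt-node-right⁻ h
    ...   | R' , h' , e = inj₁ (inj₁ (inj₂ (R' , (suc j , h') , e)))
    from : NodeNeighbour t → ng (node L R) t
    from (inj₁ (inj₁ (inj₁ (_ , (i , h) , refl)))) = i , ngAt-node-left⁺ h
    from (inj₁ (inj₁ (inj₂ (_ , (i , h) , refl)))) = suc (size L) + i , ngAt-node-right⁺ h
    from (inj₁ (inj₂ h))                            = size L , h
    from (inj₂ h)                                   = suc (size L) , h

  size-left-neighbour : ∀ {t} → LeftNeighbour t ⊎ RightNeighbour t → size (left t) ≡ size L
  size-left-neighbour (inj₁ (_ , (_ , h) , refl)) = ngAt-size h
  size-left-neighbour (inj₂ (_ , _ , refl))       = refl

  ng-node-card : ∀ {a b c d} → HasCard (ng L) a → HasCard (ng R) b →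
                 HasCard (ngAt (node L R) (size L)) c → HasCard (ngAt (node L R) (suc (size L))) d →
                 HasCard (ng (node L R)) (a + b + c + d)
  ng-node-card #L #R #before #at =
    HasCard-resp NodeNeighbour⇔ng
      (HasCard-⊎ disjoint-at (HasCard-⊎ disjoint-before
        (HasCard-⊎ disjoint-sides (HasCard-image (λ L' → node L' R) (cong left) #L)
                                  (HasCard-image (node L) (cong right) #R)) #before) #at)
    where
    disjoint-sides : ∀ {t} → LeftNeighbour t → RightNeighbour t → ⊥
    disjoint-sides (_ , (i , h) , refl) (_ , _ , e) = ngAt-irrefl L (subst (ngAt L i) (cong left e) h)

    disjoint-before : ∀ {t} → LeftNeighbour t ⊎ RightNeighbour t → ngAt (node L R) (size L) t → ⊥
    disjoint-before side h = ℕ.1+n≢n (trans (ngAt-node-before-root⁻ h) (sym (size-left-neighbour side)))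

    disjoint-at : ∀ {t} → (LeftNeighbour t ⊎ RightNeighbour t) ⊎ ngAt (node L R) (size L) t →
                  ngAt (node L R) (suc (size L)) t → ⊥
    disjoint-at (inj₁ side) h = ℕ.1+n≢n (trans (sym (ngAt-node-at-root⁻ h)) (size-left-neighbour side))
    disjoint-at (inj₂ h′)   h = ℕ.<-asym (ℕ.≤-reflexive (ngAt-node-before-root⁻ h′))
                                         (ℕ.≤-reflexive (sym (ngAt-node-at-root⁻ h)))

lemma12 : (m k : ℕ) (T : Tree) → size T ≡ m → size (left T) ≡ k ∸ 1 → size (right T) ≡ m ∸ k →
    1 ≤ m → 1 ≤ k → (a b c d : ℕ) →
    HasCard (ng (left T)) a → HasCard (ng (right T)) b →
    HasCard (ngAt T (k ∸ 1)) c → HasCard (ngAt T k) d →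
    HasCard (ng T) (a + b + c + d)
lemma12 .0 k       leaf       refl _    _ () _ _ _ _ _
lemma12 m  zero    (node L R) _    _    _ _  () _ _ _ _
lemma12 m  (suc k) (node L R) _    refl _ _  _  _ _ _ _ = ng-node-card L R
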